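{- For every even $q$ and every $k\ge 3$, the non-bipartite polyhex graph $K_o(k,q)$, with its embedding in the Klein bottle, is a cross-cap-odd embedding.
   Context: For integers $k,q\ge 1$, the lattice $L(k,q)$ has vertices $v_{i,j}$ ($0\le i\le k$, $0\le j\le q$) and edges $v_{i,j}v_{i+1,j}$ ($0\le i\le k-1$, $0\le j\le q$) and $v_{i,j}v_{i,j+1}$ ($0\le i\le k$, $0\le j\le q-1$, $i\equiv j\pmod 2$). For even $q$ and $k\ge 3$, $K_o(k,q)$ is the cubic graph embedded in the Klein bottle with all faces hexagons obtained from $L(k,q)$ by first identifying $v_{i,0}$ with $v_{i,q}$ for all $i$, then identifying $v_{0,j}$ with $v_{k,q-1-j}$ if $k$ is even and with $v_{k,q-2-j}$ if $k$ is odd (second subscripts modulo $q$); the faces are the hexagons of $L(k,q)$. A cycle of an embedded graph is 1-sided if its tubular neighbourhood is homeomorphic to a Möbius strip. An embedding of a graph in the Klein bottle is cross-cap-odd if every cycle $C$ that does not separate the surface satisfies: $C$ has odd length if and only if $C$ is 1-sided. -}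

module Defs where

open import Data.Nat using (ℕ; zero; suc; _+_; _∸_; _<_; _≤_; NonZero)
open import Data.Nat.DivMod using (_%_)
open import Data.Nat.Properties using (_<?_)
open import Data.Fin using (Fin; toℕ; fromℕ<) renaming (zero to fzero)
open import Data.Fin.Properties using ()
open import Data.List using (List; map; allFin)
open import Data.Nat.ListAction using (sum)
open import Data.Bool using (Bool; true; false; if_then_else_)
open import Data.Product using (Σ; _×_; _,_; ∃; ∃-syntax)
open import Data.Sum using (_⊎_; inj₁; inj₂)
open import Relation.Nullary using (¬_; yes; no)
open import Relation.Binary.PropositionalEquality using (_≡_)
open import Function.Definitions using (Injective)

-- Vertices of K_o(k,q): pairs (i , j) with 0 ≤ i < k, 0 ≤ j < q
-- (v_{i,j} of L(k,q) after the identifications; column k of L is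
-- identified with column 0, rows are taken modulo q).

Pt : Set
Pt = ℕ × ℕ

-- shift c in the twisted identification v_{0,j} ~ v_{k,q-c-j}:
-- c = 1 for k even, c = 2 for k odd.
twistShift : ℕ → ℕ
twistShift zero = 1
twistShift (suc zero) = 2
twistShift (suc (suc n)) = twistShift n

-- σ j = (q - c - j) mod q   (an involution on ℤ_q);
-- v_{0,j} ~ v_{k,σ j}, equivalently v_{k,j} ~ v_{0,σ j}.
σ : (k q : ℕ) .{{_ : NonZero q}} → ℕ → ℕ
σ k q j = (q + q ∸ twistShift k ∸ j) % q

module _ (k q : ℕ) .{{_ : NonZero q}} where

  data Step : Pt → Pt → Set where
    hor  : ∀ {i j} → suc i < k → j < q → Step (i , j) (suc i , j)
    ver  : ∀ {i j} → i < k → j < q → i % 2 ≡ j % 2 → Step (i , j) (i , suc j % q)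
    -- v_{k-1,j} v_{k,j} = v_{k-1,j} v_{0,σ j}  (edge across the twisted gluing)
    wrap : ∀ {j} → j < q → Step (k ∸ 1 , j) (0 , σ k q j)

  Adj : Pt → Pt → Set
  Adj u v = Step u v ⊎ Step v u

  -- Signature of the embedding (local orientations induced by the planar
  -- drawing of L(k,q) in the rectangle): the gluing of column 0 to column k
  -- reverses orientation, so exactly the wrap edges have sign -1.
  isWrapStep : ∀ {u v} → Step u v → Bool
  isWrapStep (hor _ _)   = false
  isWrapStep (ver _ _ _) = false
  isWrapStep (wrap _)    = true

  isWrap : ∀ {u v} → Adj u v → Bool
  isWrap (inj₁ s) = isWrapStep s
  isWrap (inj₂ s) = isWrapStep s

  -- image in K_o(k,q) of the vertex v_{a,b} of L(k,q) (0 ≤ a ≤ k, b mod q)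
  lpt : ℕ → ℕ → Pt
  lpt a b with a <? k
  ... | yes _ = (a , b % q)
  ... | no  _ = (0 , σ k q (b % q))

  data FaceId : Set where
    hex  : ℕ → ℕ → FaceId   -- hexagon of L(k,q) with lower-left corner v_{i,j}
    glue : ℕ → FaceId       -- hexagon formed across the twisted gluing

  ValidFace : FaceId → Set
  ValidFace (hex i j) = (i + 2 ≤ k) × (j < q) × (i % 2 ≡ j % 2)
  ValidFace (glue j)  = (j < q) × (j % 2 ≡ 1)

  bnd : FaceId → Fin 6 → Pt
  bnd (hex i j) n = go n
    where
    go : Fin 6 → Pt
    go Fin.zero = lpt i j
    go (Fin.suc Fin.zero) = lpt (suc i) j
    go (Fin.suc (Fin.suc Fin.zero)) = lpt (suc (suc i)) j
    go (Fin.suc (Fin.suc (Fin.suc Fin.zero))) = lpt (suc (suc i)) (suc j)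
    go (Fin.suc (Fin.suc (Fin.suc (Fin.suc Fin.zero)))) = lpt (suc i) (suc j)
    go (Fin.suc (Fin.suc (Fin.suc (Fin.suc (Fin.suc Fin.zero))))) = lpt i (suc j)
  bnd (glue j) n = go n
    where
    go : Fin 6 → Pt
    go Fin.zero = lpt 1 j
    go (Fin.suc Fin.zero) = lpt 0 j
    go (Fin.suc (Fin.suc Fin.zero)) = (k ∸ 1 , σ k q (j % q))
    go (Fin.suc (Fin.suc (Fin.suc Fin.zero))) = (k ∸ 1 , σ k q (suc j % q))
    go (Fin.suc (Fin.suc (Fin.suc (Fin.suc Fin.zero)))) = lpt 0 (suc j)
    go (Fin.suc (Fin.suc (Fin.suc (Fin.suc (Fin.suc Fin.zero))))) = lpt 1 (suc j)

cnext : ∀ {n} → Fin n → Fin n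
cnext {suc n} i with suc (toℕ i) <? suc n
... | yes p = fromℕ< p
... | no  _ = fzero

module _ (k q : ℕ) .{{_ : NonZero q}} where

  Consecutive : ∀ {n} → (Fin n → Pt) → Pt → Pt → Set
  Consecutive vs u v =
    ∃[ t ] ((vs t ≡ u × vs (cnext t) ≡ v) ⊎ (vs t ≡ v × vs (cnext t) ≡ u))

  OnFace : FaceId k q → Pt → Pt → Set
  OnFace f u v = Consecutive (bnd k q f) u v

  record Cycle : Set where
    field
      n     : ℕ
      vs    : Fin n → Pt
      long  : 3 ≤ n
      inj   : Injective _≡_ _≡_ vs
      adj   : (t : Fin n) → Adj k q (vs t) (vs (cnext t))

  open Cycle

  length : Cycle → ℕ
  length C = n C

  wrapCount : Cycle → ℕ
  wrapCount C = sum (map (λ t → if isWrap k q (adj C t) then 1 else 0) (allFin (n C)))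

  -- 1-sided: the product of signatures along C is -1
  OneSided : Cycle → Set
  OneSided C = wrapCount C % 2 ≡ 1

  -- C separates the surface: the faces split into two nonempty classes such
  -- that any edge not on C has both incident faces in the same class
  -- (i.e. the dual graph with the edges of C deleted is disconnected).
  Separates : Cycle → Set
  Separates C =
    Σ (FaceId k q → Bool) λ S → ((∃[ f ] (ValidFace k q f × S f ≡ true)) ×
            (∃[ g ] (ValidFace k q g × S g ≡ false)) ×
            (∀ f g u v → ValidFace k q f → ValidFace k q g → Adj k q u v →
               ¬ Consecutive (vs C) u v → OnFace f u v → OnFace g u v →
               S f ≡ S g))

  OddLength : Cycle → Set
  OddLength C = length C % 2 ≡ 1

  CrossCapOdd : Set
  CrossCapOdd = (C : Cycle) → ¬ Separates C →
                (OddLength C → OneSided C) × (OneSided C → OddLength C)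

-- Colour v_{a,b} by the parity of a + b. Every edge of L(k,q) joins vertices
-- of different colour, and since q is even, identifying rows 0 and q respects
-- the colouring. The twisted identification v_{0,j} ~ v_{k,q-c-j} reverses it,
-- because k - c is odd (c = 1 for even k, c = 2 for odd k); so in K_o(k,q)
-- exactly the edges across the gluing, i.e. the edges of signature -1, join
-- vertices of equal colour. A closed walk returns to its starting colour, so
-- its length plus its number of such edges is even. Hence every cycle,
-- separating or not, is odd exactly when it is 1-sided.
module Submission where

open import Defs
open import Data.Nat using (ℕ; _≤_; NonZero; zero; suc; _+_; _*_; _∸_; _<_; s≤s; z≤n; s<s)
open import Data.Nat.Divisibility using (_∣_; ∣⇒≤)
open import Data.Nat.DivMod using (_%_; %-distribˡ-+; [m+kn]%n≡m%n; m∣n⇒o%n%m≡o%m)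
open import Data.Nat.Properties
  using (+-0-commutativeMonoid; +-comm; +-mono-≤-<; <⇒≤; n≮n; ≤-trans; ∸-+-assoc; m∸n+n≡m; _<?_)
open import Data.Nat.Tactic.RingSolver using (solve-∀)
open import Data.Fin using (Fin; toℕ; fromℕ; inject₁) renaming (zero to fzero; suc to fsuc)
open import Data.Fin.Properties using (toℕ-injective; toℕ-fromℕ<; toℕ-inject₁; toℕ-fromℕ; toℕ<n)
open import Data.List using (map; allFin; tabulate)
open import Data.List.Properties using (map-tabulate)
open import Data.Nat.ListAction using (sum)
open import Data.Bool using (if_then_else_)
open import Data.Product using (_,_)
open import Data.Sum using (inj₁; inj₂)
open import Relation.Nullary using (yes; no; contradiction)
open import Relation.Binary.PropositionalEquality
open import Function using (_∘_; id)
open import Algebra.Properties.CommutativeMonoid.Sum +-0-commutativeMonoid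
  using (sum-cong-≗; sum-init-last; ∑-distrib-+) renaming (sum to ∑)

open ≡-Reasoning

infix 4 _≡₂_

_≡₂_ : ℕ → ℕ → Set
m ≡₂ n = m % 2 ≡ n % 2

+-cong-≡₂ : ∀ {a b c d} → a ≡₂ b → c ≡₂ d → a + c ≡₂ b + d
+-cong-≡₂ {a} {b} {c} {d} a≡b c≡d = begin
  (a + c) % 2             ≡⟨ %-distribˡ-+ a c 2 ⟩
  (a % 2 + c % 2) % 2     ≡⟨ cong₂ (λ x y → (x + y) % 2) a≡b c≡d ⟩
  (b % 2 + d % 2) % 2     ≡⟨ %-distribˡ-+ b d 2 ⟨
  (b + d) % 2             ∎

+-congˡ-≡₂ : ∀ a {c d} → c ≡₂ d → a + c ≡₂ a + d
+-congˡ-≡₂ a = +-cong-≡₂ {a} {a} refl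

+-double-assoc : ∀ m n → m + n * 2 ≡ m + n + n
+-double-assoc = solve-∀

+-double-≡₂ : ∀ m n → m + n * 2 ≡₂ m
+-double-≡₂ m n = [m+kn]%n≡m%n m n 2

∸-≡₂-+ : ∀ {m n} → n ≤ m → m ∸ n ≡₂ m + n
∸-≡₂-+ {m} {n} n≤m = begin
  (m ∸ n) % 2               ≡⟨ +-double-≡₂ (m ∸ n) n ⟨
  (m ∸ n + n * 2) % 2       ≡⟨ cong (_% 2) (+-double-assoc (m ∸ n) n) ⟩
  (m ∸ n + n + n) % 2       ≡⟨ cong (λ x → (x + n) % 2) (m∸n+n≡m n≤m) ⟩
  (m + n) % 2               ∎

%-even-≡₂ : ∀ m q .{{_ : NonZero q}} → 2 ∣ q → m % q ≡₂ m
%-even-≡₂ m q 2∣q = m∣n⇒o%n%m≡o%m 2 q m 2∣q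

+-≡₂-0⇒≡₂ : ∀ m n → m + n ≡₂ 0 → m ≡₂ n
+-≡₂-0⇒≡₂ m n m+n≡₂0 = begin
  m % 2                 ≡⟨ +-double-≡₂ m n ⟨
  (m + n * 2) % 2       ≡⟨ cong (_% 2) (+-double-assoc m n) ⟩
  (m + n + n) % 2       ≡⟨ +-cong-≡₂ {m + n} {0} {n} {n} m+n≡₂0 refl ⟩
  (0 + n) % 2           ∎

∑-cong-≡₂ : ∀ {n} (f g : Fin n → ℕ) → (∀ t → f t ≡₂ g t) → ∑ f ≡₂ ∑ g
∑-cong-≡₂ {zero}  f g f≡g = refl
∑-cong-≡₂ {suc n} f g f≡g =
  +-cong-≡₂ {f fzero} {g fzero} {∑ (f ∘ fsuc)} {∑ (g ∘ fsuc)} (f≡g fzero)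
            (∑-cong-≡₂ (f ∘ fsuc) (g ∘ fsuc) (f≡g ∘ fsuc))

sum-map-allFin : ∀ {n} (f : Fin n → ℕ) → sum (map f (allFin n)) ≡ ∑ f
sum-map-allFin {n} f = trans (cong sum (map-tabulate id f)) (sum-tabulate f)
  where
  sum-tabulate : ∀ {n} (f : Fin n → ℕ) → sum (tabulate f) ≡ ∑ f
  sum-tabulate {zero}  f = refl
  sum-tabulate {suc n} f = cong (f fzero +_) (sum-tabulate (f ∘ fsuc))

cnext-inject₁ : ∀ {m} (i : Fin m) → cnext (inject₁ i) ≡ fsuc i
cnext-inject₁ {m} i with suc (toℕ (inject₁ i)) <? suc m
... | yes p = toℕ-injective (trans (toℕ-fromℕ< p) (cong suc (toℕ-inject₁ i)))
... | no ¬p = contradiction (s<s (subst (_< m) (sym (toℕ-inject₁ i)) (toℕ<n i))) ¬p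

cnext-fromℕ : ∀ m → cnext (fromℕ m) ≡ fzero
cnext-fromℕ m with suc (toℕ (fromℕ m)) <? suc m
... | yes p = contradiction (subst (λ x → suc x < suc m) (toℕ-fromℕ m) p) (n≮n (suc m))
... | no _  = refl

∑-cnext : ∀ {n} (f : Fin n → ℕ) → ∑ (f ∘ cnext) ≡ ∑ f
∑-cnext {zero}  f = refl
∑-cnext {suc m} f = begin
  ∑ (f ∘ cnext)                                  ≡⟨ sum-init-last (f ∘ cnext) ⟩
  ∑ (f ∘ cnext ∘ inject₁) + f (cnext (fromℕ m))  ≡⟨ cong₂ _+_ (sum-cong-≗ (cong f ∘ cnext-inject₁)) (cong f (cnext-fromℕ m)) ⟩
  ∑ (f ∘ fsuc) + f fzero                         ≡⟨ +-comm _ (f fzero) ⟩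
  ∑ f                                            ∎

∑-const-1 : ∀ n → ∑ {n} (λ _ → 1) ≡ n
∑-const-1 zero    = refl
∑-const-1 (suc n) = cong suc (∑-const-1 n)

colour : Pt → ℕ
colour (a , b) = a + b

twistShift≤2 : ∀ k → twistShift k ≤ 2
twistShift≤2 zero          = s≤s z≤n
twistShift≤2 (suc zero)    = s≤s (s≤s z≤n)
twistShift≤2 (suc (suc k)) = twistShift≤2 k

pred+twistShift-≡₂0 : ∀ k → k + twistShift (suc k) ≡₂ 0
pred+twistShift-≡₂0 zero          = refl
pred+twistShift-≡₂0 (suc zero)    = refl
pred+twistShift-≡₂0 (suc (suc k)) =
  trans (cong (_% 2) (+-comm 2 (k + twistShift (suc k))))
        (trans (+-double-≡₂ (k + twistShift (suc k)) 1) (pred+twistShift-≡₂0 k))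

module _ (k q : ℕ) .{{_ : NonZero q}} where

  wrapWeightStep : ∀ {u v} → Step k q u v → ℕ
  wrapWeightStep s = if isWrapStep k q s then 1 else 0

  wrapWeight : ∀ {u v} → Adj k q u v → ℕ
  wrapWeight a = if isWrap k q a then 1 else 0

module _ (k′ q : ℕ) .{{_ : NonZero q}} (2∣q : 2 ∣ q) where

  private
    k = suc k′

  wrap-colour : ∀ {j} → j < q → colour (k′ , j) + colour (0 , σ k q j) ≡₂ 2
  wrap-colour {j} j<q = begin
    (k′ + j + (q + q ∸ c ∸ j) % q) % 2     ≡⟨ +-congˡ-≡₂ (k′ + j) (%-even-≡₂ (q + q ∸ c ∸ j) q 2∣q) ⟩
    (k′ + j + (q + q ∸ c ∸ j)) % 2         ≡⟨ cong (λ x → (k′ + j + x) % 2) (∸-+-assoc (q + q) c j) ⟩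
    (k′ + j + (q + q ∸ (c + j))) % 2       ≡⟨ +-congˡ-≡₂ (k′ + j) (∸-≡₂-+ c+j≤q+q) ⟩
    (k′ + j + (q + q + (c + j))) % 2       ≡⟨ cong (_% 2) (regroup k′ j q c) ⟩
    (k′ + c + (q + j) * 2) % 2             ≡⟨ +-double-≡₂ (k′ + c) (q + j) ⟩
    (k′ + c) % 2                           ≡⟨ pred+twistShift-≡₂0 k′ ⟩
    0                                      ∎
    where
    c = twistShift k
    c+j≤q+q : c + j ≤ q + q
    c+j≤q+q = <⇒≤ (+-mono-≤-< (≤-trans (twistShift≤2 k) (∣⇒≤ 2∣q)) j<q)
    regroup : ∀ k′ j q c → k′ + j + (q + q + (c + j)) ≡ k′ + c + (q + j) * 2
    regroup = solve-∀

  step-colour : ∀ {u v} (s : Step k q u v) → colour u + colour v ≡₂ 1 + wrapWeightStep k q s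
  step-colour (hor {i} {j} _ _) = begin
    (i + j + (suc i + j)) % 2     ≡⟨ cong (_% 2) (hor-regroup i j) ⟩
    (1 + (i + j) * 2) % 2         ≡⟨ +-double-≡₂ 1 (i + j) ⟩
    1                             ∎
    where
    hor-regroup : ∀ i j → i + j + (suc i + j) ≡ 1 + (i + j) * 2
    hor-regroup = solve-∀
  step-colour (ver {i} {j} _ _ _) = begin
    (i + j + (i + suc j % q)) % 2   ≡⟨ +-congˡ-≡₂ (i + j) (+-congˡ-≡₂ i (%-even-≡₂ (suc j) q 2∣q)) ⟩
    (i + j + (i + suc j)) % 2       ≡⟨ cong (_% 2) (ver-regroup i j) ⟩
    (1 + (i + j) * 2) % 2           ≡⟨ +-double-≡₂ 1 (i + j) ⟩
    1                               ∎
    where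
    ver-regroup : ∀ i j → i + j + (i + suc j) ≡ 1 + (i + j) * 2
    ver-regroup = solve-∀
  step-colour (wrap j<q) = wrap-colour j<q

  adj-colour : ∀ {u v} (a : Adj k q u v) → colour u + colour v ≡₂ 1 + wrapWeight k q a
  adj-colour         (inj₁ s) = step-colour s
  adj-colour {u} {v} (inj₂ s) = trans (cong (_% 2) (+-comm (colour u) (colour v))) (step-colour s)

  closed-walk-length≡₂wrapWeight : ∀ n (vs : Fin n → Pt) (adj : ∀ t → Adj k q (vs t) (vs (cnext t))) →
                                   n ≡₂ ∑ (wrapWeight k q ∘ adj)
  closed-walk-length≡₂wrapWeight n vs adj = +-≡₂-0⇒≡₂ n W (begin
    (n + W) % 2                                 ≡⟨ cong (λ x → (x + W) % 2) (∑-const-1 n) ⟨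
    (∑ {n} (λ _ → 1) + W) % 2                   ≡⟨ cong (_% 2) (∑-distrib-+ (λ _ → 1) (wrapWeight k q ∘ adj)) ⟨
    ∑ (λ t → 1 + wrapWeight k q (adj t)) % 2    ≡⟨ ∑-cong-≡₂ _ _ (λ t → sym (adj-colour (adj t))) ⟩
    ∑ (λ t → col t + col (cnext t)) % 2         ≡⟨ cong (_% 2) (∑-distrib-+ col (col ∘ cnext)) ⟩
    (∑ col + ∑ (col ∘ cnext)) % 2               ≡⟨ cong (λ x → (∑ col + x) % 2) (∑-cnext col) ⟩
    (∑ col + ∑ col) % 2                         ≡⟨ cong (_% 2) (+-double-assoc 0 (∑ col)) ⟨
    (0 + ∑ col * 2) % 2                         ≡⟨ +-double-≡₂ 0 (∑ col) ⟩
    0                                           ∎)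
    where
    W = ∑ (wrapWeight k q ∘ adj)
    col : Fin n → ℕ
    col = colour ∘ vs

open Cycle

lemma4p9 : (k q : ℕ) .{{_ : NonZero q}} → 3 ≤ k → 2 ∣ q → CrossCapOdd k q
lemma4p9 zero     q ()
lemma4p9 (suc k′) q _ 2∣q C _ = trans (sym length≡₂wrapCount) , trans length≡₂wrapCount
  where
  length≡₂wrapCount : n C ≡₂ wrapCount (suc k′) q C
  length≡₂wrapCount = trans (closed-walk-length≡₂wrapWeight k′ q 2∣q (n C) (vs C) (adj C))
                            (cong (_% 2) (sym (sum-map-allFin (wrapWeight (suc k′) q ∘ adj C))))
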